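{- Let $\mathcal{S}[\mathbf{A}]$ be a computably composite structure with base structure $\mathcal{S}$ (universe $S$) and components $\mathbf{A}=\{\mathcal{A}_x:x\in S\}$ (universes $A_x$). Suppose $\mathcal{M}$ is a computable structure and $\rho:\mathcal{S}[\mathbf{A}]\cong\mathcal{M}$ is an isomorphism. Let $\mathcal{G}$ be the substructure of $\mathcal{M}$ on the set $G=\rho(S)$. For each $g\in G$ let $\mathcal{B}_g$ be the substructure of $\mathcal{M}$ on the set $\rho(A_{\rho^{ -1}(g)})$, and let $\mathbf{B}=\{\mathcal{B}_g:g\in G\}$. Then $\mathcal{G}[\mathbf{B}]=\mathcal{M}$ is a computably composite structure.
   Context: All structures are relational. A collection $\{\mathcal{A}_x:x\in I\}$ ($I$ computable) of computable structures is uniformly computable if the languages $\mathcal{L}_x$ of the $\mathcal{A}_x$ are uniformly computable and there is a computable $f$ with $\varphi_{f(x)}$ the atomic diagram of $\mathcal{A}_x$ (universes are uniformly encoded as computable subsets of $\omega$). Given a computable $\mathcal{L}_\mathcal{S}$-structure $\mathcal{S}$ with universe $S$ and a uniformly computable collection $\mathbf{A}=\{\mathcal{A}_x:x\in S\}$ whose universes $A_x$ are pairwise disjoint and disjoint from $S$, the computable composition $\mathcal{S}[\mathbf{A}]$ is the structure with universe $S\cup\bigcup_{x\in S}A_x$ in the relational language $\{\mu\}\cup\mathcal{L}_\mathcal{S}\cup\bigcup_x\mathcal{L}_x$ ($\mu$ a new binary relation) where: $\mu=\{(a,x):x\in S,a\in A_x\}\cup\{(x,x):x\in S\}$; an $n$-ary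 $R\in\mathcal{L}_\mathcal{S}$ holds of $x_0,\dots,x_{n-1}\in S$ iff it holds in $\mathcal{S}$; an $n$-ary $Q\in\mathcal{L}_x$ holds of $a_0,\dots,a_{n-1}\in A_x$ iff it holds in $\mathcal{A}_x$; no other relations hold. A structure of this form is a computably composite structure, with base structure $\mathcal{S}$ and component structures $\mathcal{A}_x$. -}

module Defs where

open import Data.Nat using (ℕ; zero; suc; _+_; _*_; _<_; _/_)
open import Data.Fin using (Fin)
open import Data.Vec using (Vec; []; _∷_; lookup)
open import Data.List using (List; []; _∷_; length)
open import Data.List.Relation.Unary.All using (All)
open import Data.Product using (Σ; ∃; _×_; _,_)
open import Data.Sum using (_⊎_)
open import Relation.Nullary using (¬_)
open import Relation.Binary.PropositionalEquality using (_≡_)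
open import Function.Bundles using (_⇔_)

data PR : ℕ → Set where
  zeroF : ∀ {n} → PR n
  succF : PR 1
  projF : ∀ {n} → Fin n → PR n
  compF : ∀ {n m} → PR m → Vec (PR n) m → PR n
  primF : ∀ {n} → PR n → PR (suc (suc n)) → PR (suc n)
  minF  : ∀ {n} → PR (suc n) → PR n

mutual
  data Eval : ∀ {n} → PR n → Vec ℕ n → ℕ → Set where
    ev-zero : ∀ {n} {xs : Vec ℕ n} → Eval zeroF xs 0
    ev-succ : ∀ {x} → Eval succF (x ∷ []) (suc x)
    ev-proj : ∀ {n} (i : Fin n) {xs : Vec ℕ n} → Eval (projF i) xs (lookup xs i)
    ev-comp : ∀ {n m} {f : PR m} {gs : Vec (PR n) m} {xs ys z} →
              EvalVec gs xs ys → Eval f ys z → Eval (compF f gs) xs z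
    ev-prim-z : ∀ {n} {f : PR n} {g xs z} →
              Eval f xs z → Eval (primF f g) (0 ∷ xs) z
    ev-prim-s : ∀ {n} {f : PR n} {g xs k r z} →
              Eval (primF f g) (k ∷ xs) r → Eval g (k ∷ r ∷ xs) z →
              Eval (primF f g) (suc k ∷ xs) z
    ev-min  : ∀ {n} {f : PR (suc n)} {xs k} →
              Eval f (k ∷ xs) 0 →
              (∀ j → j < k → Σ ℕ (λ v → Eval f (j ∷ xs) (suc v))) →
              Eval (minF f) xs k

  data EvalVec : ∀ {n m} → Vec (PR n) m → Vec ℕ n → Vec ℕ m → Set where
    evv-[] : ∀ {n} {xs : Vec ℕ n} → EvalVec [] xs []
    evv-∷  : ∀ {n m} {g : PR n} {gs : Vec (PR n) m} {xs y ys} →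
             Eval g xs y → EvalVec gs xs ys → EvalVec (g ∷ gs) xs (y ∷ ys)

ComputablePred : (ℕ → Set) → Set
ComputablePred P =
  Σ (PR 1) λ c → ∀ k → (Eval c (k ∷ []) 1 × P k) ⊎ (Eval c (k ∷ []) 0 × ¬ P k)

UniformlyComputablePred : (I : ℕ → Set) → (ℕ → ℕ → Set) → Set
UniformlyComputablePred I P =
  Σ (PR 2) λ c → ∀ x → I x → ∀ k →
    (Eval c (x ∷ k ∷ []) 1 × P x k) ⊎ (Eval c (x ∷ k ∷ []) 0 × ¬ P x k)

⟪_,_⟫ : ℕ → ℕ → ℕ
⟪ a , b ⟫ = ((a + b) * suc (a + b)) / 2 + b

codeList : List ℕ → ℕ
codeList []       = 0
codeList (a ∷ as) = suc ⟪ a , codeList as ⟫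

-- Relational languages and structures
-- Relation symbols are pairs (n , i): the i-th symbol of arity n.
-- Universes are subsets of ω.

record Structure : Set₁ where
  field
    Lang : ℕ → ℕ → Set
    Dom  : ℕ → Set
    Rel  : ℕ → ℕ → List ℕ → Set
open Structure public

ValidTuple : Structure → ℕ → List ℕ → Set
ValidTuple 𝒜 n as = length as ≡ n × All (Dom 𝒜) as

-- code of the atomic sentence  a = b  and  R_(n,i)(as)
codeEq : ℕ → ℕ → ℕ
codeEq a b = ⟪ 0 , ⟪ a , b ⟫ ⟫

codeRel : ℕ → ℕ → List ℕ → ℕ
codeRel n i as = ⟪ 1 , ⟪ ⟪ n , i ⟫ , codeList as ⟫ ⟫

AtomicDiagram : Structure → ℕ → Set
AtomicDiagram 𝒜 k =
  (Σ ℕ λ a → Σ ℕ λ b → k ≡ codeEq a b × Dom 𝒜 a × Dom 𝒜 b × a ≡ b)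
  ⊎ (Σ ℕ λ n → Σ ℕ λ i → Σ (List ℕ) λ as →
       k ≡ codeRel n i as × Lang 𝒜 n i × ValidTuple 𝒜 n as × Rel 𝒜 n i as)

LangSet : Structure → ℕ → Set
LangSet 𝒜 k = Σ ℕ λ n → Σ ℕ λ i → k ≡ ⟪ n , i ⟫ × Lang 𝒜 n i

ComputableStructure : Structure → Set
ComputableStructure 𝒜 = ComputablePred (LangSet 𝒜) × ComputablePred (AtomicDiagram 𝒜)

UniformlyComputable : (I : ℕ → Set) → (ℕ → Structure) → Set
UniformlyComputable I 𝒜 =
  ComputablePred I
  × UniformlyComputablePred I (λ x → LangSet (𝒜 x))
  × UniformlyComputablePred I (λ x → AtomicDiagram (𝒜 x))

-- Computable composition  𝒮[𝐀]  with μ the binary symbol (2 , m)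

Composition : (𝒮 : Structure) → (𝒜 : ℕ → Structure) → (m : ℕ) → Structure
Lang (Composition 𝒮 𝒜 m) n i =
  (n ≡ 2 × i ≡ m) ⊎ Lang 𝒮 n i ⊎ (Σ ℕ λ x → Dom 𝒮 x × Lang (𝒜 x) n i)
Dom (Composition 𝒮 𝒜 m) a =
  Dom 𝒮 a ⊎ (Σ ℕ λ x → Dom 𝒮 x × Dom (𝒜 x) a)
Rel (Composition 𝒮 𝒜 m) n i as =
  (n ≡ 2 × i ≡ m × Σ ℕ λ a → Σ ℕ λ x →
      as ≡ a ∷ x ∷ [] × Dom 𝒮 x × (Dom (𝒜 x) a ⊎ a ≡ x))
  ⊎ (Lang 𝒮 n i × All (Dom 𝒮) as × Rel 𝒮 n i as)
  ⊎ (Σ ℕ λ x → Dom 𝒮 x × Lang (𝒜 x) n i × All (Dom (𝒜 x)) as × Rel (𝒜 x) n i as)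

IsComputableComposition : Structure → (ℕ → Structure) → ℕ → Set
IsComputableComposition 𝒮 𝒜 m =
  ComputableStructure 𝒮
  × UniformlyComputable (Dom 𝒮) 𝒜
  × (∀ x y a → Dom 𝒮 x → Dom 𝒮 y → Dom (𝒜 x) a → Dom (𝒜 y) a → x ≡ y)
  × (∀ x a → Dom 𝒮 x → Dom (𝒜 x) a → ¬ Dom 𝒮 a)
  × ¬ Lang 𝒮 2 m
  × (∀ x → Dom 𝒮 x → ¬ Lang (𝒜 x) 2 m)

record SameStructure (𝒜 ℬ : Structure) : Set where
  field
    sameLang : ∀ n i → Lang 𝒜 n i ⇔ Lang ℬ n i
    sameDom  : ∀ a → Dom 𝒜 a ⇔ Dom ℬ a
    sameRel  : ∀ n i as → Lang 𝒜 n i → ValidTuple 𝒜 n as →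
               Rel 𝒜 n i as ⇔ Rel ℬ n i as

record Isomorphism (𝒜 ℬ : Structure) (ρ : ℕ → ℕ) : Set where
  field
    sameLang : ∀ n i → Lang 𝒜 n i ⇔ Lang ℬ n i
    mapsDom  : ∀ a → Dom 𝒜 a → Dom ℬ (ρ a)
    injective : ∀ a b → Dom 𝒜 a → Dom 𝒜 b → ρ a ≡ ρ b → a ≡ b
    surjective : ∀ b → Dom ℬ b → Σ ℕ λ a → Dom 𝒜 a × ρ a ≡ b
    preserves : ∀ n i as → Lang 𝒜 n i → ValidTuple 𝒜 n as →
                Rel 𝒜 n i as ⇔ Rel ℬ n i (Data.List.map ρ as)

-- The structures 𝒢 and ℬ_g of the proposition.
-- Both are substructures of ℳ, taken in the language of ℳ without μ = (2 , m)
-- (so that μ is again a new symbol for the composition 𝒢[𝐁]).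

ℳ-without-μ : Structure → ℕ → ℕ → ℕ → Set
ℳ-without-μ ℳ m n i = Lang ℳ n i × ¬ (n ≡ 2 × i ≡ m)

𝒢 : (𝒮 : Structure) → (ℳ : Structure) → (ρ : ℕ → ℕ) → (m : ℕ) → Structure
Lang (𝒢 𝒮 ℳ ρ m) = ℳ-without-μ ℳ m
Dom  (𝒢 𝒮 ℳ ρ m) g = Σ ℕ λ x → Dom 𝒮 x × ρ x ≡ g
Rel  (𝒢 𝒮 ℳ ρ m) = Rel ℳ

ℬ : (𝒮 : Structure) → (𝒜 : ℕ → Structure) → (ℳ : Structure) →
    (ρ : ℕ → ℕ) → (m : ℕ) → ℕ → Structure
Lang (ℬ 𝒮 𝒜 ℳ ρ m g) = ℳ-without-μ ℳ m
Dom  (ℬ 𝒮 𝒜 ℳ ρ m g) b =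
  Σ ℕ λ x → Σ ℕ λ a → Dom 𝒮 x × ρ x ≡ g × Dom (𝒜 x) a × ρ a ≡ b
Rel  (ℬ 𝒮 𝒜 ℳ ρ m g) = Rel ℳ

-- G and each B_g are decidable inside ℳ through μ alone: since ρ carries μ of 𝒮[𝐀] onto μ of ℳ,
-- g ∈ G iff μ(g, g) holds in ℳ, and b ∈ B_g iff μ(b, g) holds and b ≠ g. Every other relation of ℳ
-- holds only of tuples lying inside G or inside a single B_g, so an atomic sentence of ℳ belongs
-- to the diagram of 𝒢 (of ℬ g) as soon as its first argument lies in G (in B_g). Hence the
-- diagrams of 𝒢 and of the ℬ g are computable from that of ℳ, uniformly in g, and the same two
-- facts show that 𝒢[𝐁] and ℳ have the same language, universe and relations.

module Submission where

open import Defs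
open import Data.Nat using (ℕ; zero; suc; _+_; _*_; _∸_; _≤_; _<_; z≤n; s≤s; pred; _/_; ∣_-_∣; _≟_)
open import Data.Nat.Properties
open import Data.Nat.DivMod using (m*n/n≡m)
open import Data.Fin using (Fin)
import Data.Fin as Fin
open import Data.Vec using (Vec; []; _∷_; lookup)
open import Data.List using (List; []; _∷_)
import Data.List as List
open import Data.List.Properties using (length-map)
open import Data.List.Relation.Unary.All as All using (All; []; _∷_)
open import Data.List.Relation.Unary.All.Properties using (map⁺)
open import Data.Product using (Σ; _×_; _,_; proj₁; proj₂)
open import Data.Sum using (_⊎_; inj₁; inj₂)
open import Data.Unit using (⊤; tt)
open import Data.Empty using (⊥-elim)
open import Function using (id)
open import Function.Bundles using (_⇔_; mk⇔; Equivalence)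
import Function.Properties.Equivalence as ⇔
open import Relation.Nullary using (¬_; yes; no)
open import Relation.Unary using (_⊆_)
open import Relation.Nullary.Decidable using (_×-dec_)
open import Relation.Binary.Definitions using (tri<; tri≈; tri>)
open import Relation.Binary.PropositionalEquality

uncurry₁ : (ℕ → ℕ) → Vec ℕ 1 → ℕ
uncurry₁ f (x ∷ []) = f x

uncurry₂ : (ℕ → ℕ → ℕ) → Vec ℕ 2 → ℕ
uncurry₂ f (x ∷ y ∷ []) = f x y

uncurry₃ : (ℕ → ℕ → ℕ → ℕ) → Vec ℕ 3 → ℕ
uncurry₃ f (x ∷ y ∷ z ∷ []) = f x y z

record Computable (n : ℕ) (f : Vec ℕ n → ℕ) : Set where
  constructor computable
  field
    code      : PR n
    evaluates : ∀ xs → Eval code xs (f xs)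

Computable₁ : (ℕ → ℕ) → Set
Computable₁ f = Computable 1 (uncurry₁ f)

Computable₂ : (ℕ → ℕ → ℕ) → Set
Computable₂ f = Computable 2 (uncurry₂ f)

Computable₃ : (ℕ → ℕ → ℕ → ℕ) → Set
Computable₃ f = Computable 3 (uncurry₃ f)

Computable-resp : ∀ {n f g} → (∀ xs → f xs ≡ g xs) → Computable n f → Computable n g
Computable-resp f≗g (computable c ev) =
  computable c (λ xs → subst (Eval c xs) (f≗g xs) (ev xs))

zeroᶜ : ∀ {n} → Computable n (λ _ → 0)
zeroᶜ = computable zeroF (λ _ → ev-zero)

sucᶜ : Computable₁ suc
sucᶜ = computable succF (λ { (x ∷ []) → ev-succ })

projᶜ : ∀ {n} (i : Fin n) → Computable n (λ xs → lookup xs i)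
projᶜ i = computable (projF i) (λ _ → ev-proj i)

π₀ : ∀ {n} → Computable (1 + n) (λ xs → lookup xs Fin.zero)
π₀ = projᶜ Fin.zero

π₁ : ∀ {n} → Computable (2 + n) (λ xs → lookup xs (Fin.suc Fin.zero))
π₁ = projᶜ (Fin.suc Fin.zero)

π₃ : ∀ {n} → Computable (4 + n) (λ xs → lookup xs (Fin.suc (Fin.suc (Fin.suc Fin.zero))))
π₃ = projᶜ (Fin.suc (Fin.suc (Fin.suc Fin.zero)))

compose₁ : ∀ {n f g} → Computable₁ f → Computable n g → Computable n (λ xs → f (g xs))
compose₁ {g = g} (computable cf evf) (computable cg evg) =
  computable (compF cf (cg ∷ []))
             (λ xs → ev-comp (evv-∷ (evg xs) evv-[]) (evf (g xs ∷ [])))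

compose₂ : ∀ {n f g h} → Computable₂ f → Computable n g → Computable n h →
           Computable n (λ xs → f (g xs) (h xs))
compose₂ {g = g} {h} (computable cf evf) (computable cg evg) (computable ch evh) =
  computable (compF cf (cg ∷ ch ∷ []))
             (λ xs → ev-comp (evv-∷ (evg xs) (evv-∷ (evh xs) evv-[])) (evf (g xs ∷ h xs ∷ [])))

compose₃ : ∀ {n f g h k} → Computable₃ f → Computable n g → Computable n h → Computable n k →
           Computable n (λ xs → f (g xs) (h xs) (k xs))
compose₃ {g = g} {h} {k} (computable cf evf) (computable cg evg) (computable ch evh)
         (computable ck evk) =
  computable (compF cf (cg ∷ ch ∷ ck ∷ []))
             (λ xs → ev-comp (evv-∷ (evg xs) (evv-∷ (evh xs) (evv-∷ (evk xs) evv-[])))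
                             (evf (g xs ∷ h xs ∷ k xs ∷ [])))

primRecᶜ : ∀ {n F G} {f : Vec ℕ (suc n) → ℕ} → Computable n F → Computable (2 + n) G →
           (∀ xs → f (0 ∷ xs) ≡ F xs) →
           (∀ k xs → f (suc k ∷ xs) ≡ G (k ∷ f (k ∷ xs) ∷ xs)) →
           Computable (suc n) f
primRecᶜ {f = f} (computable cF evF) (computable cG evG) f-zero f-suc =
  computable (primF cF cG) evaluates
  where
  evaluates : ∀ xs → Eval (primF cF cG) xs (f xs)
  evaluates (zero ∷ xs)  = subst (Eval _ _) (sym (f-zero xs)) (ev-prim-z (evF xs))
  evaluates (suc k ∷ xs) =
    subst (Eval _ _) (sym (f-suc k xs)) (ev-prim-s (evaluates (k ∷ xs)) (evG _))

constᶜ : ∀ {n} c → Computable n (λ _ → c)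
constᶜ zero    = zeroᶜ
constᶜ (suc c) = compose₁ sucᶜ (constᶜ c)

if0_then_else_ : ∀ {a} {A : Set a} → ℕ → A → A → A
if0 zero  then x else y = x
if0 suc _ then x else y = y

if0ᶜ : Computable₃ if0_then_else_
if0ᶜ = primRecᶜ π₀ π₃ (λ { (x ∷ y ∷ []) → refl }) (λ { k (x ∷ y ∷ []) → refl })

+ᶜ : Computable₂ _+_
+ᶜ = primRecᶜ π₀ (compose₁ sucᶜ π₁) (λ { (y ∷ []) → refl }) (λ { k (y ∷ []) → refl })

predᶜ : Computable₁ pred
predᶜ = primRecᶜ zeroᶜ π₀ (λ { [] → refl }) (λ { k [] → refl })

∸ᶜ : Computable₂ _∸_
∸ᶜ = Computable-resp (λ { (x ∷ y ∷ []) → refl }) (compose₂ flipped π₁ π₀)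
  where
  flipped : Computable₂ (λ y x → x ∸ y)
  flipped = primRecᶜ π₀ (compose₁ predᶜ π₁) (λ { (x ∷ []) → refl })
                     (λ { k (x ∷ []) → sym (pred[m∸n]≡m∸[1+n] x k) })

m∸n+n∸m≡∣m-n∣ : ∀ m n → (m ∸ n) + (n ∸ m) ≡ ∣ m - n ∣
m∸n+n∸m≡∣m-n∣ zero    zero    = refl
m∸n+n∸m≡∣m-n∣ zero    (suc n) = refl
m∸n+n∸m≡∣m-n∣ (suc m) zero    = +-identityʳ (suc m)
m∸n+n∸m≡∣m-n∣ (suc m) (suc n) = m∸n+n∸m≡∣m-n∣ m n

∣-∣ᶜ : Computable₂ ∣_-_∣
∣-∣ᶜ = Computable-resp (λ { (m ∷ n ∷ []) → m∸n+n∸m≡∣m-n∣ m n })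
                       (compose₂ +ᶜ (compose₂ ∸ᶜ π₀ π₁) (compose₂ ∸ᶜ π₁ π₀))

triangle : ℕ → ℕ
triangle zero    = 0
triangle (suc s) = triangle s + suc s

triangleᶜ : Computable₁ triangle
triangleᶜ = primRecᶜ zeroᶜ (compose₂ +ᶜ π₁ (compose₁ sucᶜ π₀)) (λ { [] → refl }) (λ { k [] → refl })

triangle*2 : ∀ s → triangle s * 2 ≡ s * suc s
triangle*2 zero    = refl
triangle*2 (suc s) = begin
  (triangle s + suc s) * 2      ≡⟨ *-distribʳ-+ 2 (triangle s) (suc s) ⟩
  triangle s * 2 + suc s * 2    ≡⟨ cong (_+ suc s * 2) (trans (triangle*2 s) (*-comm s (suc s))) ⟩
  suc s * s + suc s * 2         ≡⟨ sym (*-distribˡ-+ (suc s) s 2) ⟩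
  suc s * (s + 2)               ≡⟨ cong (suc s *_) (+-comm s 2) ⟩
  suc s * suc (suc s)           ∎
  where open ≡-Reasoning

⟪⟫≡triangle : ∀ a b → ⟪ a , b ⟫ ≡ triangle (a + b) + b
⟪⟫≡triangle a b = cong (_+ b) (begin
  (a + b) * suc (a + b) / 2     ≡⟨ cong (_/ 2) (triangle*2 (a + b)) ⟨
  triangle (a + b) * 2 / 2      ≡⟨ m*n/n≡m (triangle (a + b)) 2 ⟩
  triangle (a + b)              ∎)
  where open ≡-Reasoning

⟪⟫ᶜ : Computable₂ ⟪_,_⟫
⟪⟫ᶜ = Computable-resp (λ { (a ∷ b ∷ []) → sym (⟪⟫≡triangle a b) })
                      (compose₂ +ᶜ (compose₁ triangleᶜ (compose₂ +ᶜ π₀ π₁)) π₁)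

triangle-mono : ∀ {s t} → s ≤ t → triangle s ≤ triangle t
triangle-mono z≤n       = z≤n
triangle-mono (s≤s s≤t) = +-mono-≤ (triangle-mono s≤t) (s≤s s≤t)

diagonal-step : ℕ → ℕ → ℕ
diagonal-step k s = if0 triangle (suc s) ∸ suc k then suc s else s

diagonal : ℕ → ℕ
diagonal zero    = 0
diagonal (suc k) = diagonal-step k (diagonal k)

diagonalᶜ : Computable₁ diagonal
diagonalᶜ = primRecᶜ zeroᶜ stepᶜ (λ { [] → refl }) (λ { k [] → refl })
  where
  stepᶜ : Computable₂ diagonal-step
  stepᶜ = Computable-resp (λ { (k ∷ s ∷ []) → refl })
    (compose₃ if0ᶜ (compose₂ ∸ᶜ (compose₁ triangleᶜ (compose₁ sucᶜ π₁)) (compose₁ sucᶜ π₀))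
                   (compose₁ sucᶜ π₁) π₁)

diagonal-step-cases : ∀ k s →
  (triangle (suc s) ≤ suc k × diagonal-step k s ≡ suc s) ⊎
  (suc k < triangle (suc s) × diagonal-step k s ≡ s)
diagonal-step-cases k s with triangle (suc s) ∸ suc k in eq
... | zero  = inj₁ (m∸n≡0⇒m≤n eq , refl)
... | suc _ = inj₂ (≰⇒> (λ t≤k → 0≢1+n (trans (sym (m≤n⇒m∸n≡0 t≤k)) eq)) , refl)

diagonal-bounds : ∀ k → triangle (diagonal k) ≤ k × k < triangle (suc (diagonal k))
diagonal-bounds zero = z≤n , s≤s z≤n
diagonal-bounds (suc k) with diagonal-step-cases k (diagonal k) | diagonal-bounds k
... | inj₁ (t≤ , step≡) | (_ , k<t) rewrite step≡ =
  t≤ , ≤-trans (s≤s k<t) (m<m+n (triangle (suc (diagonal k))) (s≤s z≤n))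
... | inj₂ (<t , step≡) | (t≤ , _) rewrite step≡ = m≤n⇒m≤1+n t≤ , <t

diagonal-unique : ∀ {s k} → triangle s ≤ k → k < triangle (suc s) → diagonal k ≡ s
diagonal-unique {s} {k} t≤k k<t with <-cmp (diagonal k) s | diagonal-bounds k
... | tri< d<s _ _ | (_ , k<t′) =
  ⊥-elim (<-irrefl refl (<-≤-trans k<t′ (≤-trans (triangle-mono d<s) t≤k)))
... | tri≈ _ d≡s _ | _         = d≡s
... | tri> _ _ s<d | (t′≤k , _) =
  ⊥-elim (<-irrefl refl (<-≤-trans k<t (≤-trans (triangle-mono s<d) t′≤k)))

diagonal-⟪⟫ : ∀ a b → diagonal ⟪ a , b ⟫ ≡ a + b
diagonal-⟪⟫ a b rewrite ⟪⟫≡triangle a b =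
  diagonal-unique (m≤m+n (triangle (a + b)) b) (+-monoʳ-< (triangle (a + b)) (s≤s (m≤n+m b a)))

unpair₂ : ℕ → ℕ
unpair₂ k = k ∸ triangle (diagonal k)

unpair₁ : ℕ → ℕ
unpair₁ k = diagonal k ∸ unpair₂ k

unpair₂-⟪⟫ : ∀ a b → unpair₂ ⟪ a , b ⟫ ≡ b
unpair₂-⟪⟫ a b rewrite diagonal-⟪⟫ a b | ⟪⟫≡triangle a b = m+n∸m≡n (triangle (a + b)) b

unpair₁-⟪⟫ : ∀ a b → unpair₁ ⟪ a , b ⟫ ≡ a
unpair₁-⟪⟫ a b rewrite unpair₂-⟪⟫ a b | diagonal-⟪⟫ a b = m+n∸n≡m a b

unpair₂ᶜ : Computable₁ unpair₂
unpair₂ᶜ = Computable-resp (λ { (k ∷ []) → refl })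
  (compose₂ ∸ᶜ π₀ (compose₁ triangleᶜ (compose₁ diagonalᶜ π₀)))

unpair₁ᶜ : Computable₁ unpair₁
unpair₁ᶜ = Computable-resp (λ { (k ∷ []) → refl })
  (compose₂ ∸ᶜ (compose₁ diagonalᶜ π₀) (compose₁ unpair₂ᶜ π₀))

⟪⟫-injective : ∀ {a b c d} → ⟪ a , b ⟫ ≡ ⟪ c , d ⟫ → a ≡ c × b ≡ d
⟪⟫-injective {a} {b} {c} {d} eq =
  trans (sym (unpair₁-⟪⟫ a b)) (trans (cong unpair₁ eq) (unpair₁-⟪⟫ c d)) ,
  trans (sym (unpair₂-⟪⟫ a b)) (trans (cong unpair₂ eq) (unpair₂-⟪⟫ c d))

_Decides_ : ℕ → Set → Set
b Decides A = (b ≡ 1 × A) ⊎ (b ≡ 0 × ¬ A)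

Characteristic : (ℕ → ℕ) → (ℕ → Set) → Set
Characteristic χ P = ∀ k → χ k Decides P k

notBit : ℕ → ℕ
notBit b = if0 b then 1 else 0

andBit : ℕ → ℕ → ℕ
andBit b c = if0 b then 0 else c

eqBit : ℕ → ℕ → ℕ
eqBit x y = if0 ∣ x - y ∣ then 1 else 0

1-decides-⊤ : 1 Decides ⊤
1-decides-⊤ = inj₁ (refl , tt)

Decides-resp-⇔ : ∀ {b A B} → A ⇔ B → b Decides A → b Decides B
Decides-resp-⇔ A⇔B (inj₁ (b≡1 , a))  = inj₁ (b≡1 , Equivalence.to A⇔B a)
Decides-resp-⇔ A⇔B (inj₂ (b≡0 , ¬a)) = inj₂ (b≡0 , λ b → ¬a (Equivalence.from A⇔B b))

if0-decides : ∀ c {b b′ A B} → b Decides A → b′ Decides B →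
              (if0 c then b else b′) Decides (if0 c then A else B)
if0-decides zero    d _ = d
if0-decides (suc _) _ d = d

notBit-decides : ∀ {b A} → b Decides A → notBit b Decides (¬ A)
notBit-decides (inj₁ (refl , a))  = inj₂ (refl , λ ¬a → ¬a a)
notBit-decides (inj₂ (refl , ¬a)) = inj₁ (refl , ¬a)

andBit-decides : ∀ {b c A B} → b Decides A → c Decides B → andBit b c Decides (A × B)
andBit-decides (inj₂ (refl , ¬a)) _                  = inj₂ (refl , λ ab → ¬a (proj₁ ab))
andBit-decides (inj₁ (refl , a))  (inj₁ (refl , b))  = inj₁ (refl , (a , b))
andBit-decides (inj₁ (refl , a))  (inj₂ (refl , ¬b)) = inj₂ (refl , λ ab → ¬b (proj₂ ab))

eqBit-decides : ∀ x y → eqBit x y Decides (x ≡ y)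
eqBit-decides x y with ∣ x - y ∣ in eq
... | zero  = inj₁ (refl , ∣m-n∣≡0⇒m≡n eq)
... | suc _ = inj₂ (refl , λ { refl → 0≢1+n (trans (sym (∣n-n∣≡0 x)) eq) })

notBitᶜ : Computable₁ notBit
notBitᶜ = Computable-resp (λ { (b ∷ []) → refl }) (compose₃ if0ᶜ π₀ (constᶜ 1) (constᶜ 0))

andBitᶜ : Computable₂ andBit
andBitᶜ = Computable-resp (λ { (b ∷ c ∷ []) → refl }) (compose₃ if0ᶜ π₀ (constᶜ 0) π₁)

eqBitᶜ : Computable₂ eqBit
eqBitᶜ = Computable-resp (λ { (x ∷ y ∷ []) → refl })
                         (compose₃ if0ᶜ (compose₂ ∣-∣ᶜ π₀ π₁) (constᶜ 1) (constᶜ 0))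

evaluation-decides : ∀ {n} {c : PR n} {xs v A} → Eval c xs v → v Decides A →
                     (Eval c xs 1 × A) ⊎ (Eval c xs 0 × ¬ A)
evaluation-decides ev (inj₁ (refl , a))  = inj₁ (ev , a)
evaluation-decides ev (inj₂ (refl , ¬a)) = inj₂ (ev , ¬a)

computablePred : ∀ {χ P} → Computable₁ χ → Characteristic χ P → ComputablePred P
computablePred (computable c ev) χ-char = c , λ k → evaluation-decides (ev (k ∷ [])) (χ-char k)

uniformlyComputablePred : ∀ {χ I P} → Computable₂ χ → (∀ x → Characteristic (χ x) (P x)) →
                          UniformlyComputablePred I P
uniformlyComputablePred (computable c ev) χ-char =
  c , λ x _ k → evaluation-decides (ev (x ∷ k ∷ [])) (χ-char x k)

record ComputableCharacteristic (P : ℕ → Set) : Set where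
  field
    χ                : ℕ → ℕ
    χ-computable     : Computable₁ χ
    χ-characteristic : Characteristic χ P

characteristic : ∀ {P} → ComputablePred P → ComputableCharacteristic P
characteristic {P} (c , decided) = record
  { χ                = λ k → proj₁ (output k)
  ; χ-computable     = computable c (λ { (k ∷ []) → proj₁ (proj₂ (output k)) })
  ; χ-characteristic = λ k → proj₂ (proj₂ (output k))
  }
  where
  output : ∀ k → Σ ℕ λ v → Eval c (k ∷ []) v × v Decides P k
  output k with decided k
  ... | inj₁ (ev , p)  = 1 , ev , inj₁ (refl , p)
  ... | inj₂ (ev , ¬p) = 0 , ev , inj₂ (refl , ¬p)

codeList-injective : ∀ {as bs} → codeList as ≡ codeList bs → as ≡ bs
codeList-injective {[]}     {[]}     _  = refl
codeList-injective {a ∷ as} {b ∷ bs} eq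
  with ⟪⟫-injective {a} {codeList as} {b} {codeList bs} (suc-injective eq)
... | a≡b , as≡bs = cong₂ _∷_ a≡b (codeList-injective as≡bs)

codeEq≢codeRel : ∀ {a b n i as} → ¬ codeEq a b ≡ codeRel n i as
codeEq≢codeRel {a} {b} {n} {i} {as} eq =
  0≢1+n (proj₁ (⟪⟫-injective {0} {⟪ a , b ⟫} {1} {⟪ ⟪ n , i ⟫ , codeList as ⟫} eq))

codeRel-injective : ∀ {n i as n′ i′ as′} → codeRel n i as ≡ codeRel n′ i′ as′ →
                    n ≡ n′ × i ≡ i′ × as ≡ as′
codeRel-injective {n} {i} {as} {n′} {i′} {as′} eq
  with ⟪⟫-injective {⟪ n , i ⟫} {codeList as} {⟪ n′ , i′ ⟫} {codeList as′}
         (proj₂ (⟪⟫-injective {1} {_} {1} {⟪ ⟪ n′ , i′ ⟫ , codeList as′ ⟫} eq))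
... | ni≡ni′ , as≡as′ with ⟪⟫-injective {n} {i} {n′} {i′} ni≡ni′
... | n≡n′ , i≡i′ = n≡n′ , i≡i′ , codeList-injective as≡as′

binaryCodeRelᶜ : ∀ n i → Computable₂ (λ a b → codeRel n i (a ∷ b ∷ []))
binaryCodeRelᶜ n i = Computable-resp (λ { (a ∷ b ∷ []) → refl })
  (compose₂ ⟪⟫ᶜ (constᶜ 1)
    (compose₂ ⟪⟫ᶜ (constᶜ ⟪ n , i ⟫)
      (compose₁ sucᶜ (compose₂ ⟪⟫ᶜ π₀ (compose₁ sucᶜ (compose₂ ⟪⟫ᶜ π₁ (constᶜ 0)))))))

atomicDiagram-codeRel⇔ : ∀ 𝒜 {n i as} → AtomicDiagram 𝒜 (codeRel n i as) ⇔
                         (Lang 𝒜 n i × ValidTuple 𝒜 n as × Rel 𝒜 n i as)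
atomicDiagram-codeRel⇔ 𝒜 {n} {i} {as} = mk⇔ to (λ (L , V , R) → inj₂ (n , i , as , refl , L , V , R))
  where
  to : AtomicDiagram 𝒜 (codeRel n i as) → Lang 𝒜 n i × ValidTuple 𝒜 n as × Rel 𝒜 n i as
  to (inj₁ (a , b , eq , _)) = ⊥-elim (codeEq≢codeRel {a} {b} {n} {i} {as} (sym eq))
  to (inj₂ (n′ , i′ , as′ , eq , L , V , R)) with codeRel-injective {n} {i} {as} {n′} {i′} {as′} eq
  ... | refl , refl , refl = L , V , R

module Substructure (ℳ : Structure) (m : ℕ) where

  μ-code : ℕ
  μ-code = ⟪ 2 , m ⟫

  -- 𝒢 and ℬ g of the statement are, definitionally, Sub of their universes.
  Sub : (ℕ → Set) → Structure
  Sub P = record { Lang = ℳ-without-μ ℳ m ; Dom = P ; Rel = Rel ℳ }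

  ClosedUnderRelations : (ℕ → Set) → Set
  ClosedUnderRelations P = ∀ {n i b rest} → ℳ-without-μ ℳ m n i → ValidTuple ℳ n (b ∷ rest) →
                           Rel ℳ n i (b ∷ rest) → P b → All P (b ∷ rest)

  μ∉Sub : ¬ ℳ-without-μ ℳ m 2 m
  μ∉Sub (_ , ≢μ) = ≢μ (refl , refl)

  ≢μ⇔≢μ-code : ∀ {n i} → (¬ (n ≡ 2 × i ≡ m)) ⇔ (¬ ⟪ n , i ⟫ ≡ μ-code)
  ≢μ⇔≢μ-code {n} {i} = mk⇔ (λ ≢μ eq → ≢μ (⟪⟫-injective {n} {i} {2} {m} eq))
                           (λ ≢μ-code → λ { (refl , refl) → ≢μ-code refl })

  HeadIn : (ℕ → Set) → ℕ → Set
  HeadIn P l = if0 l then ⊤ else P (unpair₁ (pred l))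

  -- Reading k as the code of an atomic sentence, SentenceIn P k says that it speaks about Sub P:
  -- a ∈ P for a = b, and R ≠ μ with the first argument (if any) in P for R(as).
  SentenceIn : (ℕ → Set) → ℕ → Set
  SentenceIn P k = if0 unpair₁ k then P (unpair₁ (unpair₂ k))
                   else (¬ unpair₁ (unpair₂ k) ≡ μ-code × HeadIn P (unpair₂ (unpair₂ k)))

  HeadIn-codeList : ∀ P b rest → HeadIn P (codeList (b ∷ rest)) ≡ P b
  HeadIn-codeList P b rest = cong P (unpair₁-⟪⟫ b (codeList rest))

  SentenceIn-⟪⟫ : ∀ P t r → SentenceIn P ⟪ t , r ⟫ ≡
                  (if0 t then P (unpair₁ r) else (¬ unpair₁ r ≡ μ-code × HeadIn P (unpair₂ r)))
  SentenceIn-⟪⟫ P t r =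
    cong₂ (λ t r → if0 t then P (unpair₁ r) else (¬ unpair₁ r ≡ μ-code × HeadIn P (unpair₂ r)))
          (unpair₁-⟪⟫ t r) (unpair₂-⟪⟫ t r)

  SentenceIn-codeEq : ∀ P a b → SentenceIn P (codeEq a b) ≡ P a
  SentenceIn-codeEq P a b = trans (SentenceIn-⟪⟫ P 0 ⟪ a , b ⟫) (cong P (unpair₁-⟪⟫ a b))

  SentenceIn-codeRel : ∀ P n i as → SentenceIn P (codeRel n i as) ≡
                       (¬ ⟪ n , i ⟫ ≡ μ-code × HeadIn P (codeList as))
  SentenceIn-codeRel P n i as =
    trans (SentenceIn-⟪⟫ P 1 ⟪ ⟪ n , i ⟫ , codeList as ⟫)
          (cong₂ (λ ni l → ¬ ni ≡ μ-code × HeadIn P l)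
                 (unpair₁-⟪⟫ ⟪ n , i ⟫ (codeList as)) (unpair₂-⟪⟫ ⟪ n , i ⟫ (codeList as)))

  All⇒HeadIn : ∀ {P as} → All P as → HeadIn P (codeList as)
  All⇒HeadIn []                 = tt
  All⇒HeadIn {P} (_∷_ {b} {rest} Pb _) = subst id (sym (HeadIn-codeList P b rest)) Pb

  HeadIn⇒All : ∀ {P n i as} → ClosedUnderRelations P → ℳ-without-μ ℳ m n i → ValidTuple ℳ n as →
               Rel ℳ n i as → HeadIn P (codeList as) → All P as
  HeadIn⇒All {as = []}         _      _ _ _ _  = []
  HeadIn⇒All {P} {as = b ∷ rest} closed L V R Pb = closed L V R (subst id (HeadIn-codeList P b rest) Pb)

  langSet-Sub⇔ : ∀ {P k} → LangSet (Sub P) k ⇔ (LangSet ℳ k × ¬ k ≡ μ-code)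
  langSet-Sub⇔ =
    mk⇔ (λ { (n , i , refl , L , ≢μ) → (n , i , refl , L) , Equivalence.to ≢μ⇔≢μ-code ≢μ })
        (λ { ((n , i , refl , L) , ≢μ) → n , i , refl , L , Equivalence.from ≢μ⇔≢μ-code ≢μ })

  atomicDiagram-Sub⇔ : ∀ {P} → P ⊆ Dom ℳ → ClosedUnderRelations P → ∀ k →
                       AtomicDiagram (Sub P) k ⇔ (AtomicDiagram ℳ k × SentenceIn P k)
  atomicDiagram-Sub⇔ {P} P⊆ℳ closed k = mk⇔ to from
    where
    to : AtomicDiagram (Sub P) k → AtomicDiagram ℳ k × SentenceIn P k
    to (inj₁ (a , b , refl , Pa , Pb , a≡b)) =
      inj₁ (a , b , refl , P⊆ℳ Pa , P⊆ℳ Pb , a≡b) , subst id (sym (SentenceIn-codeEq P a b)) Pa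
    to (inj₂ (n , i , as , refl , (L , ≢μ) , (len , Pas) , R)) =
      inj₂ (n , i , as , refl , L , (len , All.map P⊆ℳ Pas) , R) ,
      subst id (sym (SentenceIn-codeRel P n i as)) (Equivalence.to ≢μ⇔≢μ-code ≢μ , All⇒HeadIn Pas)

    from : AtomicDiagram ℳ k × SentenceIn P k → AtomicDiagram (Sub P) k
    from (inj₁ (a , _ , refl , _ , _ , refl) , Pa′) =
      let Pa = subst id (SentenceIn-codeEq P a a) Pa′ in inj₁ (a , a , refl , Pa , Pa , refl)
    from (inj₂ (n , i , as , refl , L , V@(len , _) , R) , s)
      with subst id (SentenceIn-codeRel P n i as) s
    ... | ≢μ , head =
      let L′ = L , Equivalence.from ≢μ⇔≢μ-code ≢μ
      in inj₂ (n , i , as , refl , L′ , (len , HeadIn⇒All closed L′ V R head) , R)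

  headBit : (ℕ → ℕ) → ℕ → ℕ
  headBit χ l = if0 l then 1 else χ (unpair₁ (pred l))

  sentenceBit : (ℕ → ℕ) → ℕ → ℕ
  sentenceBit χ k = if0 unpair₁ k then χ (unpair₁ (unpair₂ k))
                    else andBit (notBit (eqBit (unpair₁ (unpair₂ k)) μ-code))
                                (headBit χ (unpair₂ (unpair₂ k)))

  sentenceBit-characteristic : ∀ {χ P} → Characteristic χ P →
                               Characteristic (sentenceBit χ) (SentenceIn P)
  sentenceBit-characteristic χ-char k =
    if0-decides (unpair₁ k) (χ-char _)
      (andBit-decides (notBit-decides (eqBit-decides _ μ-code))
                      (if0-decides (unpair₂ (unpair₂ k)) 1-decides-⊤ (χ-char _)))

  sentenceBitᶜ : ∀ {χ} → Computable₂ χ → Computable₂ (λ g → sentenceBit (χ g))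
  sentenceBitᶜ χᶜ = Computable-resp (λ { (g ∷ k ∷ []) → refl })
    (compose₃ if0ᶜ (compose₁ unpair₁ᶜ π₁)
      (compose₂ χᶜ π₀ leftᶜ)
      (compose₂ andBitᶜ (compose₁ notBitᶜ (compose₂ eqBitᶜ leftᶜ (constᶜ μ-code)))
                        (compose₃ if0ᶜ rightᶜ (constᶜ 1)
                                  (compose₂ χᶜ π₀ (compose₁ unpair₁ᶜ (compose₁ predᶜ rightᶜ))))))
    where
    leftᶜ : Computable 2 (λ xs → unpair₁ (unpair₂ (lookup xs (Fin.suc Fin.zero))))
    leftᶜ = compose₁ unpair₁ᶜ (compose₁ unpair₂ᶜ π₁)

    rightᶜ : Computable 2 (λ xs → unpair₂ (unpair₂ (lookup xs (Fin.suc Fin.zero))))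
    rightᶜ = compose₁ unpair₂ᶜ (compose₁ unpair₂ᶜ π₁)

module ComputableSubstructures (ℳ : Structure) (m : ℕ) (ℳ-computable : ComputableStructure ℳ) where

  open Substructure ℳ m
  open ComputableCharacteristic (characteristic (proj₁ ℳ-computable))
    renaming (χ to langℳ; χ-computable to langℳᶜ; χ-characteristic to langℳ-characteristic)
  open ComputableCharacteristic (characteristic (proj₂ ℳ-computable))
    renaming (χ to diagramℳ; χ-computable to diagramℳᶜ; χ-characteristic to diagramℳ-characteristic)

  langBit : ℕ → ℕ
  langBit k = andBit (langℳ k) (notBit (eqBit k μ-code))

  langBitᶜ : Computable₁ langBit
  langBitᶜ = Computable-resp (λ { (k ∷ []) → refl })
    (compose₂ andBitᶜ (compose₁ langℳᶜ π₀) (compose₁ notBitᶜ (compose₂ eqBitᶜ π₀ (constᶜ μ-code))))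

  langBit-characteristic : ∀ P → Characteristic langBit (LangSet (Sub P))
  langBit-characteristic P k = Decides-resp-⇔ (⇔.sym (langSet-Sub⇔ {P} {k}))
    (andBit-decides (langℳ-characteristic k) (notBit-decides (eqBit-decides k μ-code)))

  diagramBit : (ℕ → ℕ) → ℕ → ℕ
  diagramBit χ k = andBit (diagramℳ k) (sentenceBit χ k)

  diagramBitᶜ : ∀ {χ} → Computable₂ χ → Computable₂ (λ g → diagramBit (χ g))
  diagramBitᶜ χᶜ = Computable-resp (λ { (g ∷ k ∷ []) → refl })
    (compose₂ andBitᶜ (compose₁ diagramℳᶜ π₁) (sentenceBitᶜ χᶜ))

  diagramBit-characteristic : ∀ {χ P} → P ⊆ Dom ℳ → ClosedUnderRelations P →
                              Characteristic χ P → Characteristic (diagramBit χ) (AtomicDiagram (Sub P))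
  diagramBit-characteristic P⊆ℳ closed χ-char k =
    Decides-resp-⇔ (⇔.sym (atomicDiagram-Sub⇔ P⊆ℳ closed k))
    (andBit-decides (diagramℳ-characteristic k) (sentenceBit-characteristic χ-char k))

  computableSubstructure : ∀ {P χ} → P ⊆ Dom ℳ → ClosedUnderRelations P →
                           Computable₁ χ → Characteristic χ P → ComputableStructure (Sub P)
  computableSubstructure {P} {χ} P⊆ℳ closed χᶜ χ-char =
    computablePred langBitᶜ (langBit-characteristic P) ,
    computablePred (Computable-resp (λ { (k ∷ []) → refl })
                                    (compose₂ (diagramBitᶜ ignoringFirstᶜ) π₀ π₀))
                   (diagramBit-characteristic P⊆ℳ closed χ-char)
    where
    ignoringFirstᶜ : Computable₂ (λ _ → χ)
    ignoringFirstᶜ = Computable-resp (λ { (_ ∷ k ∷ []) → refl }) (compose₁ χᶜ π₁)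

  uniformlyComputableSubstructures :
    ∀ {I : ℕ → Set} {P : ℕ → ℕ → Set} {χ : ℕ → ℕ → ℕ} →
    ComputablePred I → (∀ g → P g ⊆ Dom ℳ) → (∀ g → ClosedUnderRelations (P g)) →
    Computable₂ χ → (∀ g → Characteristic (χ g) (P g)) → UniformlyComputable I (λ g → Sub (P g))
  uniformlyComputableSubstructures {P = P} I-computable P⊆ℳ closed χᶜ χ-char =
    I-computable ,
    uniformlyComputablePred {λ _ → langBit}
      (Computable-resp (λ { (_ ∷ k ∷ []) → refl }) (compose₁ langBitᶜ π₁))
                            (λ g → langBit-characteristic (P g)) ,
    uniformlyComputablePred (diagramBitᶜ χᶜ)
      (λ g → diagramBit-characteristic (P⊆ℳ g) (closed g) (χ-char g))

μ-Composition⇔ : ∀ {𝒮 𝒜 m a x} → ¬ Lang 𝒮 2 m → (∀ y → Dom 𝒮 y → ¬ Lang (𝒜 y) 2 m) →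
                 Rel (Composition 𝒮 𝒜 m) 2 m (a ∷ x ∷ []) ⇔ (Dom 𝒮 x × (Dom (𝒜 x) a ⊎ a ≡ x))
μ-Composition⇔ {𝒮} {𝒜} {m} {a} {x} μ∉𝒮 μ∉𝒜 =
  mk⇔ to (λ (Sx , a∈Ax) → inj₁ (refl , refl , a , x , refl , Sx , a∈Ax))
  where
  to : Rel (Composition 𝒮 𝒜 m) 2 m (a ∷ x ∷ []) → Dom 𝒮 x × (Dom (𝒜 x) a ⊎ a ≡ x)
  to (inj₁ (_ , _ , _ , _ , refl , Sx , a∈Ax)) = Sx , a∈Ax
  to (inj₂ (inj₁ (μ∈𝒮 , _)))                  = ⊥-elim (μ∉𝒮 μ∈𝒮)
  to (inj₂ (inj₂ (y , Sy , μ∈𝒜y , _)))        = ⊥-elim (μ∉𝒜 y Sy μ∈𝒜y)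

module Recomposition
  (𝒮 : Structure) (𝒜 : ℕ → Structure) (m : ℕ) (ℳ : Structure) (ρ : ℕ → ℕ)
  (𝐀-disjoint : ∀ x y a → Dom 𝒮 x → Dom 𝒮 y → Dom (𝒜 x) a → Dom (𝒜 y) a → x ≡ y)
  (𝐀-disjoint-𝒮 : ∀ x a → Dom 𝒮 x → Dom (𝒜 x) a → ¬ Dom 𝒮 a)
  (μ∉𝒮 : ¬ Lang 𝒮 2 m) (μ∉𝐀 : ∀ x → Dom 𝒮 x → ¬ Lang (𝒜 x) 2 m)
  (ρ-iso : Isomorphism (Composition 𝒮 𝒜 m) ℳ ρ) where

  open Isomorphism ρ-iso
  open Substructure ℳ m using (ClosedUnderRelations)

  𝒮[𝐀] : Structure
  𝒮[𝐀] = Composition 𝒮 𝒜 m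

  InG : ℕ → Set
  InG = Dom (𝒢 𝒮 ℳ ρ m)

  InB : ℕ → ℕ → Set
  InB g = Dom (ℬ 𝒮 𝒜 ℳ ρ m g)

  μ∈ℳ : Lang ℳ 2 m
  μ∈ℳ = Equivalence.to (sameLang 2 m) (inj₁ (refl , refl))

  ρ-injective : ∀ {a b} → Dom 𝒮[𝐀] a → Dom 𝒮[𝐀] b → ρ a ≡ ρ b → a ≡ b
  ρ-injective = injective _ _

  InG⊆ℳ : ∀ {g} → InG g → Dom ℳ g
  InG⊆ℳ (x , Sx , refl) = mapsDom x (inj₁ Sx)

  InB⊆ℳ : ∀ {g b} → InB g b → Dom ℳ b
  InB⊆ℳ (x , a , Sx , _ , Aa , refl) = mapsDom a (inj₂ (x , Sx , Aa))

  InB⇒InG : ∀ {g b} → InB g b → InG g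
  InB⇒InG (x , _ , Sx , ρx≡g , _) = x , Sx , ρx≡g

  G∩B-disjoint : ∀ {g b} → InG b → ¬ InB g b
  G∩B-disjoint (x , Sx , refl) (y , a , Sy , _ , Aa , ρa≡ρx)
    with ρ-injective (inj₂ (y , Sy , Aa)) (inj₁ Sx) ρa≡ρx
  ... | refl = 𝐀-disjoint-𝒮 y a Sy Aa Sx

  B-disjoint : ∀ {g h b} → InB g b → InB h b → g ≡ h
  B-disjoint (x , a , Sx , refl , Aa , refl) (y , a′ , Sy , refl , Aa′ , ρa′≡ρa)
    with ρ-injective (inj₂ (y , Sy , Aa′)) (inj₂ (x , Sx , Aa)) ρa′≡ρa
  ... | refl = cong ρ (𝐀-disjoint x y a Sx Sy Aa Aa′)

  μℳ⇔ : ∀ {a g} → Dom ℳ a → Dom ℳ g → Rel ℳ 2 m (a ∷ g ∷ []) ⇔ (InG g × (InB g a ⊎ a ≡ g))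
  μℳ⇔ a∈ℳ g∈ℳ with surjective _ a∈ℳ | surjective _ g∈ℳ
  ... | z , z∈𝒮[𝐀] , refl | x , x∈𝒮[𝐀] , refl =
    ⇔.trans (⇔.sym (preserves 2 m (z ∷ x ∷ []) (inj₁ (refl , refl)) (refl , z∈𝒮[𝐀] ∷ x∈𝒮[𝐀] ∷ [])))
            (⇔.trans (μ-Composition⇔ {𝒮} {𝒜} μ∉𝒮 μ∉𝐀) (mk⇔ to from))
    where
    to : Dom 𝒮 x × (Dom (𝒜 x) z ⊎ z ≡ x) → InG (ρ x) × (InB (ρ x) (ρ z) ⊎ ρ z ≡ ρ x)
    to (Sx , inj₁ Az)   = (x , Sx , refl) , inj₁ (x , z , Sx , refl , Az , refl)
    to (Sx , inj₂ refl) = (x , Sx , refl) , inj₂ refl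

    from : InG (ρ x) × (InB (ρ x) (ρ z) ⊎ ρ z ≡ ρ x) → Dom 𝒮 x × (Dom (𝒜 x) z ⊎ z ≡ x)
    from (_ , inj₁ (y , z′ , Sy , ρy≡ρx , Az′ , ρz′≡ρz))
      with ρ-injective (inj₁ Sy) x∈𝒮[𝐀] ρy≡ρx | ρ-injective (inj₂ (y , Sy , Az′)) z∈𝒮[𝐀] ρz′≡ρz
    ... | refl | refl = Sy , inj₁ Az′
    from ((x′ , Sx′ , ρx′≡ρx) , inj₂ ρz≡ρx)
      with ρ-injective (inj₁ Sx′) x∈𝒮[𝐀] ρx′≡ρx | ρ-injective z∈𝒮[𝐀] x∈𝒮[𝐀] ρz≡ρx
    ... | refl | refl = Sx′ , inj₂ refl

  InG⇔μ : ∀ g → InG g ⇔ AtomicDiagram ℳ (codeRel 2 m (g ∷ g ∷ []))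
  InG⇔μ g = ⇔.trans (mk⇔ to from) (⇔.sym (atomicDiagram-codeRel⇔ ℳ))
    where
    to : InG g → Lang ℳ 2 m × ValidTuple ℳ 2 (g ∷ g ∷ []) × Rel ℳ 2 m (g ∷ g ∷ [])
    to Gg = μ∈ℳ , (refl , InG⊆ℳ Gg ∷ InG⊆ℳ Gg ∷ []) ,
            Equivalence.from (μℳ⇔ (InG⊆ℳ Gg) (InG⊆ℳ Gg)) (Gg , inj₂ refl)

    from : Lang ℳ 2 m × ValidTuple ℳ 2 (g ∷ g ∷ []) × Rel ℳ 2 m (g ∷ g ∷ []) → InG g
    from (_ , (_ , g∈ℳ ∷ _) , R) = proj₁ (Equivalence.to (μℳ⇔ g∈ℳ g∈ℳ) R)

  InB⇔μ : ∀ g b → InB g b ⇔ (AtomicDiagram ℳ (codeRel 2 m (b ∷ g ∷ [])) × ¬ b ≡ g)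
  InB⇔μ g b = mk⇔ to from
    where
    to : InB g b → AtomicDiagram ℳ (codeRel 2 m (b ∷ g ∷ [])) × ¬ b ≡ g
    to Bb =
      let Gg = InB⇒InG Bb in
      Equivalence.from (atomicDiagram-codeRel⇔ ℳ)
        (μ∈ℳ , (refl , InB⊆ℳ Bb ∷ InG⊆ℳ Gg ∷ []) ,
         Equivalence.from (μℳ⇔ (InB⊆ℳ Bb) (InG⊆ℳ Gg)) (Gg , inj₁ Bb)) ,
      λ { refl → G∩B-disjoint Gg Bb }

    from : AtomicDiagram ℳ (codeRel 2 m (b ∷ g ∷ [])) × ¬ b ≡ g → InB g b
    from (μbg , b≢g) with Equivalence.to (atomicDiagram-codeRel⇔ ℳ {2} {m} {b ∷ g ∷ []}) μbg
    ... | _ , (_ , b∈ℳ ∷ g∈ℳ ∷ []) , R with proj₂ (Equivalence.to (μℳ⇔ b∈ℳ g∈ℳ) R)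
    ... | inj₁ Bb  = Bb
    ... | inj₂ b≡g = ⊥-elim (b≢g b≡g)

  preimages : ∀ as → All (Dom ℳ) as → Σ (List ℕ) λ bs → All (Dom 𝒮[𝐀]) bs × List.map ρ bs ≡ as
  preimages []       []            = [] , [] , refl
  preimages (a ∷ as) (a∈ℳ ∷ as∈ℳ) with surjective a a∈ℳ | preimages as as∈ℳ
  ... | b , b∈𝒮[𝐀] , refl | bs , bs∈𝒮[𝐀] , refl = b ∷ bs , b∈𝒮[𝐀] ∷ bs∈𝒮[𝐀] , refl

  InOnePart : List ℕ → Set
  InOnePart as = All InG as ⊎ Σ ℕ λ g → InG g × All (InB g) as

  relation-inOnePart : ∀ {n i as} → ℳ-without-μ ℳ m n i → ValidTuple ℳ n as → Rel ℳ n i as →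
                       InOnePart as
  relation-inOnePart {n} {i} {as} (L , ≢μ) (len , as∈ℳ) R with preimages as as∈ℳ
  ... | bs , bs∈𝒮[𝐀] , refl
    with Equivalence.from (preserves n i bs (Equivalence.from (sameLang n i) L)
                                     (trans (sym (length-map ρ bs)) len , bs∈𝒮[𝐀])) R
  ... | inj₁ (n≡2 , i≡m , _)                = ⊥-elim (≢μ (n≡2 , i≡m))
  ... | inj₂ (inj₁ (_ , bs∈𝒮 , _))          = inj₁ (map⁺ (All.map (λ Sb → _ , Sb , refl) bs∈𝒮))
  ... | inj₂ (inj₂ (y , Sy , _ , bs∈𝒜y , _)) =
    inj₂ (ρ y , (y , Sy , refl) , map⁺ (All.map (λ Ab → y , _ , Sy , refl , Ab , refl) bs∈𝒜y))

  G-closed : ClosedUnderRelations InG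
  G-closed L V R Gb with relation-inOnePart L V R
  ... | inj₁ all-G           = all-G
  ... | inj₂ (_ , _ , Bb ∷ _) = ⊥-elim (G∩B-disjoint Gb Bb)

  B-closed : ∀ g → ClosedUnderRelations (InB g)
  B-closed g L V R Bb with relation-inOnePart L V R
  ... | inj₁ (Gb ∷ _)       = ⊥-elim (G∩B-disjoint Gb Bb)
  ... | inj₂ (_ , _ , all-B) with B-disjoint (All.head all-B) Bb
  ... | refl = all-B

  𝒢[𝐁] : Structure
  𝒢[𝐁] = Composition (𝒢 𝒮 ℳ ρ m) (ℬ 𝒮 𝒜 ℳ ρ m) m

  lang-𝒢[𝐁]⇔ : ∀ n i → Lang 𝒢[𝐁] n i ⇔ Lang ℳ n i
  lang-𝒢[𝐁]⇔ n i = mk⇔ to from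
    where
    to : Lang 𝒢[𝐁] n i → Lang ℳ n i
    to (inj₁ (refl , refl))          = μ∈ℳ
    to (inj₂ (inj₁ (L , _)))         = L
    to (inj₂ (inj₂ (_ , _ , L , _))) = L

    from : Lang ℳ n i → Lang 𝒢[𝐁] n i
    from L with (n ≟ 2) ×-dec (i ≟ m)
    ... | yes μ≡ = inj₁ μ≡
    ... | no ≢μ  = inj₂ (inj₁ (L , ≢μ))

  dom-𝒢[𝐁]⇔ : ∀ a → Dom 𝒢[𝐁] a ⇔ Dom ℳ a
  dom-𝒢[𝐁]⇔ a = mk⇔ to from
    where
    to : Dom 𝒢[𝐁] a → Dom ℳ a
    to (inj₁ Ga)           = InG⊆ℳ Ga
    to (inj₂ (_ , _ , Ba)) = InB⊆ℳ Ba

    from : Dom ℳ a → Dom 𝒢[𝐁] a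
    from a∈ℳ with surjective a a∈ℳ
    ... | x , inj₁ Sx , refl            = inj₁ (x , Sx , refl)
    ... | z , inj₂ (y , Sy , Az) , refl = inj₂ (ρ y , (y , Sy , refl) , (y , z , Sy , refl , Az , refl))

  rel-𝒢[𝐁]-μ⇔ : ∀ {a g} → Dom ℳ a → Dom ℳ g → Rel 𝒢[𝐁] 2 m (a ∷ g ∷ []) ⇔ Rel ℳ 2 m (a ∷ g ∷ [])
  rel-𝒢[𝐁]-μ⇔ {a} {g} a∈ℳ g∈ℳ = mk⇔ to from
    where
    to : Rel 𝒢[𝐁] 2 m (a ∷ g ∷ []) → Rel ℳ 2 m (a ∷ g ∷ [])
    to (inj₁ (_ , _ , _ , _ , refl , Gg , a∈Bg))  = Equivalence.from (μℳ⇔ a∈ℳ g∈ℳ) (Gg , a∈Bg)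
    to (inj₂ (inj₁ ((_ , ≢μ) , _)))              = ⊥-elim (≢μ (refl , refl))
    to (inj₂ (inj₂ (_ , _ , (_ , ≢μ) , _)))      = ⊥-elim (≢μ (refl , refl))

    from : Rel ℳ 2 m (a ∷ g ∷ []) → Rel 𝒢[𝐁] 2 m (a ∷ g ∷ [])
    from R = inj₁ (refl , refl , a , g , refl , Equivalence.to (μℳ⇔ a∈ℳ g∈ℳ) R)

  rel-𝒢[𝐁]-≢μ⇔ : ∀ {n i as} → ℳ-without-μ ℳ m n i → ValidTuple ℳ n as → Rel 𝒢[𝐁] n i as ⇔ Rel ℳ n i as
  rel-𝒢[𝐁]-≢μ⇔ {n} {i} {as} L@(_ , ≢μ) V = mk⇔ to from
    where
    to : Rel 𝒢[𝐁] n i as → Rel ℳ n i as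
    to (inj₁ (n≡2 , i≡m , _))          = ⊥-elim (≢μ (n≡2 , i≡m))
    to (inj₂ (inj₁ (_ , _ , R)))         = R
    to (inj₂ (inj₂ (_ , _ , _ , _ , R))) = R

    from : Rel ℳ n i as → Rel 𝒢[𝐁] n i as
    from R with relation-inOnePart L V R
    ... | inj₁ as∈G             = inj₂ (inj₁ (L , as∈G , R))
    ... | inj₂ (g , Gg , as∈Bg) = inj₂ (inj₂ (g , Gg , L , as∈Bg , R))

  rel-𝒢[𝐁]⇔ : ∀ n i as → Lang 𝒢[𝐁] n i → ValidTuple 𝒢[𝐁] n as → Rel 𝒢[𝐁] n i as ⇔ Rel ℳ n i as
  rel-𝒢[𝐁]⇔ n i as L (len , as∈𝒢[𝐁])
    with (n ≟ 2) ×-dec (i ≟ m) | All.map (Equivalence.to (dom-𝒢[𝐁]⇔ _)) as∈𝒢[𝐁]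
  rel-𝒢[𝐁]⇔ _ _ (a ∷ g ∷ []) _ _ | yes (refl , refl) | a∈ℳ ∷ g∈ℳ ∷ [] = rel-𝒢[𝐁]-μ⇔ a∈ℳ g∈ℳ
  rel-𝒢[𝐁]⇔ _ _ []            _ (() , _) | yes (refl , refl) | _
  rel-𝒢[𝐁]⇔ _ _ (_ ∷ [])      _ (() , _) | yes (refl , refl) | _
  rel-𝒢[𝐁]⇔ _ _ (_ ∷ _ ∷ _ ∷ _) _ (() , _) | yes (refl , refl) | _
  ... | no ≢μ | as∈ℳ = rel-𝒢[𝐁]-≢μ⇔ (Equivalence.to (lang-𝒢[𝐁]⇔ n i) L , ≢μ) (len , as∈ℳ)

  recomposition : SameStructure 𝒢[𝐁] ℳ
  recomposition = record
    { sameLang = lang-𝒢[𝐁]⇔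
    ; sameDom  = dom-𝒢[𝐁]⇔
    ; sameRel  = rel-𝒢[𝐁]⇔
    }

  module ComputableParts (ℳ-computable : ComputableStructure ℳ) where

    open ComputableCharacteristic (characteristic (proj₂ ℳ-computable))
      renaming (χ to diagramℳ; χ-computable to diagramℳᶜ; χ-characteristic to diagramℳ-characteristic)

    inGBit : ℕ → ℕ
    inGBit g = diagramℳ (codeRel 2 m (g ∷ g ∷ []))

    inGBitᶜ : Computable₁ inGBit
    inGBitᶜ = Computable-resp (λ { (g ∷ []) → refl })
      (compose₁ diagramℳᶜ (compose₂ (binaryCodeRelᶜ 2 m) π₀ π₀))

    inGBit-characteristic : Characteristic inGBit InG
    inGBit-characteristic g = Decides-resp-⇔ (⇔.sym (InG⇔μ g)) (diagramℳ-characteristic _)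

    inBBit : ℕ → ℕ → ℕ
    inBBit g b = andBit (diagramℳ (codeRel 2 m (b ∷ g ∷ []))) (notBit (eqBit b g))

    inBBitᶜ : Computable₂ inBBit
    inBBitᶜ = Computable-resp (λ { (g ∷ b ∷ []) → refl })
      (compose₂ andBitᶜ (compose₁ diagramℳᶜ (compose₂ (binaryCodeRelᶜ 2 m) π₁ π₀))
                        (compose₁ notBitᶜ (compose₂ eqBitᶜ π₁ π₀)))

    inBBit-characteristic : ∀ g → Characteristic (inBBit g) (InB g)
    inBBit-characteristic g b = Decides-resp-⇔ (⇔.sym (InB⇔μ g b))
      (andBit-decides (diagramℳ-characteristic _) (notBit-decides (eqBit-decides b g)))

proposition2p8 : (𝒮 : Structure) (𝒜 : ℕ → Structure) (m : ℕ)
    (ℳ : Structure) (ρ : ℕ → ℕ) →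
    IsComputableComposition 𝒮 𝒜 m →
    ComputableStructure ℳ →
    Isomorphism (Composition 𝒮 𝒜 m) ℳ ρ →
    IsComputableComposition (𝒢 𝒮 ℳ ρ m) (ℬ 𝒮 𝒜 ℳ ρ m) m
      × SameStructure (Composition (𝒢 𝒮 ℳ ρ m) (ℬ 𝒮 𝒜 ℳ ρ m) m) ℳ
proposition2p8 𝒮 𝒜 m ℳ ρ (_ , _ , 𝐀-disjoint , 𝐀-disjoint-𝒮 , μ∉𝒮 , μ∉𝐀) ℳ-computable ρ-iso =
  ( computableSubstructure InG⊆ℳ G-closed inGBitᶜ inGBit-characteristic
  , uniformlyComputableSubstructures (computablePred inGBitᶜ inGBit-characteristic)
                                     (λ _ → InB⊆ℳ) B-closed inBBitᶜ inBBit-characteristic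
  , (λ _ _ _ _ _ → B-disjoint)
  , (λ _ _ _ Bb Gb → G∩B-disjoint Gb Bb)
  , μ∉Sub
  , (λ _ _ → μ∉Sub) )
  , recomposition
  where
  open Recomposition 𝒮 𝒜 m ℳ ρ 𝐀-disjoint 𝐀-disjoint-𝒮 μ∉𝒮 μ∉𝐀 ρ-iso
  open ComputableParts ℳ-computable
  open Substructure ℳ m using (μ∉Sub)
  open ComputableSubstructures ℳ m ℳ-computable
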